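{- If the weak $3x+1$ conjecture is true, then the wild semigroup $\mathcal{W}$ consists exactly of all positive rational numbers $a/b$ (in lowest terms, $a,b$ positive integers) with $\gcd(a,3b)=1$.
   Context: For integers $n\ge 0$ let $g(n)=\frac{3n+2}{2n+1}$. The wild semigroup $\mathcal{W}$ is the multiplicative semigroup of positive rationals generated by $\{g(n): n\ge 0\}$ together with $\frac12$ (all finite products, repetitions allowed). The weak $3x+1$ conjecture is the assertion that the semigroup $\mathcal{W}^{ -1}=\{w^{ -1}: w\in\mathcal{W}\}$ (generated by $\{\frac{2n+1}{3n+2}: n\ge 0\}$ together with $2$) contains every positive integer. -}

module Defs where

open import Data.Nat using (ℕ; suc; _*_; _+_; _≤_)
open import Data.Integer using (+_)
open import Data.Rational using (ℚ; _/_) renaming (_*_ to _*ℚ_)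

g : ℕ → ℚ
g n = (+ (3 * n + 2)) / suc (2 * n)

gInv : ℕ → ℚ
gInv n = (+ (2 * n + 1)) / suc (suc (3 * n))

data InW : ℚ → Set where
  W-gen  : ∀ n → InW (g n)
  W-half : InW ((+ 1) / 2)
  W-mul  : ∀ {p q} → InW p → InW q → InW (p *ℚ q)

data InWinv : ℚ → Set where
  Winv-gen : ∀ n → InWinv (gInv n)
  Winv-two : InWinv ((+ 2) / 1)
  Winv-mul : ∀ {p q} → InWinv p → InWinv q → InWinv (p *ℚ q)

Weak3x+1 : Set
Weak3x+1 = ∀ (n : ℕ) → 1 ≤ n → InWinv ((+ n) / 1)

-- Each generator of 𝒲 is positive with numerator dividing 1 or some 3n + 2, so every element of 𝒲
-- is positive with numerator prime to 3. Conversely, the weak conjecture puts every 1/b in 𝒲, so it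
-- suffices that 𝒲 contains each integer n prime to 3, which we show by strong induction on n.
-- For odd n it is enough to have an odd t ∈ 𝒲 with t ≡ 2 (mod n): since 2 + 3h = g(h)(1 + 2h), and
-- factors 2 may be traded for t, one climbs from x = 1 to odd x ∈ 𝒲 with 1 + 2x ≡ 3ᵏ (mod n) for
-- every k ≥ 1, and when 3ᵏ ≡ 1 the modulus n divides x. Such a t is built from smaller elements
-- according to n mod 12, or from 17 ∈ 𝒲 when n < 12.

module Submission where

open import Defs

open import Data.Empty using (⊥-elim)
open import Data.Fin using (Fin; toℕ; fromℕ<; suc)
open import Data.Fin.Patterns using (0F; 1F; 2F; 3F; 4F; 5F; 6F; 7F; 8F; 9F)
open import Data.Fin.Properties using (pigeonhole; toℕ-fromℕ<)
open import Data.Integer as ℤ using (+_; -[1+_]; ∣_∣)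
open import Data.Integer.Properties as ℤ using ()
open import Data.List using (List; []; _∷_; foldl)
open import Data.Nat
open import Data.Nat.Coprimality as Coprime using (Coprime; coprime-divisor; 1-coprimeTo)
open import Data.Nat.Divisibility
open import Data.Nat.DivMod hiding (_mod_)
open import Data.Nat.GeneralisedArithmetic using (fold)
open import Data.Nat.Induction using (<-rec)
open import Data.Nat.Primality using (Prime; prime[2]; prime?; prime⇒irreducible; prime⇒nonTrivial; euclidsLemma)
open import Data.Nat.Properties
open import Data.Nat.Tactic.RingSolver using (solve-∀)
open import Data.Product using (∃-syntax; _×_; _,_)
open import Data.Rational as ℚ using (ℚ; mkℚ; 0ℚ; 1ℚ; ½; ↥_; ↧ₙ_; Positive)
open import Data.Rational.Properties as ℚ using ()
open import Data.Rational.Unnormalised as ℚᵘ using (mkℚᵘ)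
open import Data.Rational.Unnormalised.Properties as ℚᵘ using ()
open import Data.Sum using (inj₁; inj₂)
open import Function.Bundles using (_⇔_; mk⇔)
open import Relation.Binary.PropositionalEquality
open import Relation.Nullary using (¬_; yes; no)
open import Relation.Nullary.Decidable using (from-yes; from-no)

prime[3] : Prime 3
prime[3] = from-yes (prime? 3)

prime∤⇒coprime : ∀ {p n} → Prime p → ¬ p ∣ n → Coprime n p
prime∤⇒coprime p-prime p∤n (d∣n , d∣p) with prime⇒irreducible p-prime d∣p
... | inj₁ d≡1  = d≡1
... | inj₂ refl = ⊥-elim (p∤n d∣n)

coprime-* : ∀ {n a b} → Coprime n a → Coprime n b → Coprime n (a * b)
coprime-* n⊥a n⊥b (d∣n , d∣ab) =
  n⊥b (d∣n , coprime-divisor (λ (e∣d , e∣a) → n⊥a (∣-trans e∣d d∣n , e∣a)) d∣ab)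

coprime-^ : ∀ {n a} → Coprime n a → ∀ k → Coprime n (a ^ k)
coprime-^ {n} n⊥a zero    = Coprime.sym (1-coprimeTo n)
coprime-^     n⊥a (suc k) = coprime-* n⊥a (coprime-^ n⊥a k)

2s≡n+j⇒coprime : ∀ {n j s} → Coprime n j → 2 * s ≡ n + j → Coprime n s
2s≡n+j⇒coprime n⊥j 2s≡n+j {d} (d∣n , d∣s) =
  n⊥j (d∣n , ∣m+n∣m⇒∣n (subst (d ∣_) 2s≡n+j (∣n⇒∣m*n 2 d∣s)) d∣n)

infix 4 _≡_mod_

_≡_mod_ : ℕ → ℕ → (n : ℕ) → .{{NonZero n}} → Set
_≡_mod_ a b n = a % n ≡ b % n

module _ {n : ℕ} .{{_ : NonZero n}} where

  open ≡-Reasoning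

  +-cong-mod : ∀ {a b c d} → a ≡ b mod n → c ≡ d mod n → a + c ≡ b + d mod n
  +-cong-mod {a} {b} {c} {d} a≡b c≡d = begin
    (a + c) % n          ≡⟨ %-distribˡ-+ a c n ⟩
    (a % n + c % n) % n  ≡⟨ cong₂ (λ x y → (x + y) % n) a≡b c≡d ⟩
    (b % n + d % n) % n  ≡⟨ %-distribˡ-+ b d n ⟨
    (b + d) % n          ∎

  *-cong-mod : ∀ {a b c d} → a ≡ b mod n → c ≡ d mod n → a * c ≡ b * d mod n
  *-cong-mod {a} {b} {c} {d} a≡b c≡d = begin
    (a * c) % n          ≡⟨ %-distribˡ-* a c n ⟩
    (a % n * (c % n)) % n  ≡⟨ cong₂ (λ x y → (x * y) % n) a≡b c≡d ⟩
    (b % n * (d % n)) % n  ≡⟨ %-distribˡ-* b d n ⟨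
    (b * d) % n          ∎

  ≡-mod⇒∣∸ : ∀ {a b} → a ≡ b mod n → n ∣ b ∸ a
  ≡-mod⇒∣∸ {a} {b} a≡b = divides (b / n ∸ a / n) (begin
    b ∸ a                                      ≡⟨ cong₂ _∸_ (m≡m%n+[m/n]*n b n) (m≡m%n+[m/n]*n a n) ⟩
    (b % n + b / n * n) ∸ (a % n + a / n * n)  ≡⟨ cong (λ r → (b % n + b / n * n) ∸ (r + a / n * n)) a≡b ⟩
    (b % n + b / n * n) ∸ (b % n + a / n * n)  ≡⟨ [m+n]∸[m+o]≡n∸o (b % n) _ _ ⟩
    b / n * n ∸ a / n * n                      ≡⟨ *-distribʳ-∸ n (b / n) (a / n) ⟨
    (b / n ∸ a / n) * n                        ∎)

  ∣∸⇒≡-mod : ∀ {a b} → a ≤ b → n ∣ b ∸ a → a ≡ b mod n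
  ∣∸⇒≡-mod {a} {b} a≤b (divides k b∸a≡kn) = begin
    a % n            ≡⟨ [m+kn]%n≡m%n a k n ⟨
    (a + k * n) % n  ≡⟨ cong (λ x → (a + x) % n) b∸a≡kn ⟨
    (a + (b ∸ a)) % n ≡⟨ cong (_% n) (m+[n∸m]≡n a≤b) ⟩
    b % n            ∎

  *-cancelˡ-mod : ∀ {c a b} → Coprime n c → c * a ≡ c * b mod n → a ≡ b mod n
  *-cancelˡ-mod {c} {a} {b} n⊥c ca≡cb with ≤-total a b
  ... | inj₁ a≤b = ∣∸⇒≡-mod a≤b (coprime-divisor n⊥c
                     (subst (n ∣_) (sym (*-distribˡ-∸ c b a)) (≡-mod⇒∣∸ ca≡cb)))
  ... | inj₂ b≤a = sym (∣∸⇒≡-mod b≤a (coprime-divisor n⊥c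
                     (subst (n ∣_) (sym (*-distribˡ-∸ c a b)) (≡-mod⇒∣∸ (sym ca≡cb)))))

  -- Two of the n + 1 powers a⁰, …, aⁿ agree modulo n; cancel the smaller one.
  ∃-order : ∀ {a} → Coprime n a → ∃[ m ] a ^ suc m ≡ 1 mod n
  ∃-order {a} n⊥a with pigeonhole (n<1+n n) (λ i → fromℕ< (m%n<n (a ^ toℕ i) n))
  ... | i , j , i<j , aⁱ≡aʲ with m≤n⇒∃[o]m+o≡n i<j
  ...   | m , 1+i+m≡j = m , *-cancelˡ-mod (coprime-^ n⊥a (toℕ i)) (begin
    (a ^ toℕ i * a ^ suc m) % n  ≡⟨ cong (_% n) (^-distribˡ-+-* a (toℕ i) (suc m)) ⟨
    a ^ (toℕ i + suc m) % n      ≡⟨ cong (λ e → a ^ e % n) (trans (+-suc (toℕ i) m) 1+i+m≡j) ⟩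
    a ^ toℕ j % n                ≡⟨ toℕ-fromℕ< _ ⟨
    toℕ (fromℕ< (m%n<n (a ^ toℕ j) n)) ≡⟨ cong toℕ aⁱ≡aʲ ⟨
    toℕ (fromℕ< (m%n<n (a ^ toℕ i) n)) ≡⟨ toℕ-fromℕ< _ ⟩
    a ^ toℕ i % n                ≡⟨ cong (_% n) (*-identityʳ (a ^ toℕ i)) ⟨
    (a ^ toℕ i * 1) % n          ∎)

Odd : ℕ → Set
Odd n = ∃[ h ] n ≡ 1 + 2 * h

odd-* : ∀ {a b} → Odd a → Odd b → Odd (a * b)
odd-* (h , refl) (k , refl) = h + k + 2 * h * k , lemma h k
  where
  lemma : ∀ h k → (1 + 2 * h) * (1 + 2 * k) ≡ 1 + 2 * (h + k + 2 * h * k)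
  lemma = solve-∀

odd-^ : ∀ {a} → Odd a → ∀ k → Odd (a ^ k)
odd-^ a-odd zero    = 0 , refl
odd-^ a-odd (suc k) = odd-* a-odd (odd-^ a-odd k)

odd⇒∤2 : ∀ {a} → Odd a → ¬ 2 ∣ a
odd⇒∤2 (h , refl) (divides q 1+2h≡q*2) = even≢odd q h (trans (*-comm 2 q) (sym 1+2h≡q*2))

data EvenOrOdd : ℕ → Set where
  even : ∀ m → EvenOrOdd (2 * m)
  odd  : ∀ m → EvenOrOdd (1 + 2 * m)

even-or-odd : ∀ n → EvenOrOdd n
even-or-odd zero = even 0
even-or-odd (suc n) with even-or-odd n
... | even m = odd m
... | odd m  = subst EvenOrOdd (*-distribˡ-+ 2 1 m) (even (suc m))

-- The closure properties of 𝒲 ∩ ℕ: 3k+2∈ is multiplication by g(k), and *-cancelʳ is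
-- multiplication by 1/(b + 1) ∈ 𝒲, available under the weak 3x+1 conjecture.
record WildClosed (R : ℕ → Set) : Set where
  field
    2∈        : R 2
    17∈       : R 17
    *-closed  : ∀ {a b} → R a → R b → R (a * b)
    *-cancelʳ : ∀ {a b} → R (a * suc b) → R a
    3k+2∈     : ∀ {k} → R (1 + 2 * k) → R (2 + 3 * k)

module WildClosedProperties {R : ℕ → Set} (closed : WildClosed R) where

  open WildClosed closed
  open ≡-Reasoning

  1∈ : R 1
  1∈ = *-cancelʳ 2∈

  ^-closed : ∀ {a} → R a → ∀ k → R (a ^ k)
  ^-closed a∈ zero    = 1∈
  ^-closed a∈ (suc k) = *-closed a∈ (^-closed a∈ k)

  ∣-closed : ∀ {d x} → R x → d ∣ x → 0 < x → R d
  ∣-closed {d} x∈ (divides (suc q) refl) _ = *-cancelʳ (subst R (*-comm (suc q) d) x∈)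

  module _ {n} .{{_ : NonZero n}} (n-odd : Odd n) (3∤n : ¬ 3 ∣ n)
           {t} (t∈ : R t) (t-odd : Odd t) (t≡2 : t ≡ 2 mod n) where

    odd-representative : ∀ y → 0 < y → R y → ∃[ x ] R x × Odd x × x ≡ y mod n
    odd-representative = <-rec _ go
      where
      go : ∀ y → (∀ {z} → z < y → 0 < z → R z → ∃[ x ] R x × Odd x × x ≡ z mod n) →
           0 < y → R y → ∃[ x ] R x × Odd x × x ≡ y mod n
      go y IH 0<y y∈ with even-or-odd y
      ... | odd h         = y , y∈ , (h , refl) , refl
      ... | even (suc z) with IH (m<m+n (suc z) z<s) z<s (∣-closed y∈ (divides 2 refl) 0<y)
      ...   | x , x∈ , x-odd , x≡z = t * x , *-closed t∈ x∈ , odd-* t-odd x-odd , *-cong-mod t≡2 x≡z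

    -- From x = 1 + 2h pass to an odd x′ ≡ 2(2 + 3h): then 1 + 2x′ ≡ 3(1 + 2x) (mod n).
    3-powers : ∀ k → ∃[ x ] R x × Odd x × 1 + 2 * x ≡ 3 ^ suc k mod n
    3-powers zero = 1 , 1∈ , (0 , refl) , refl
    3-powers (suc k) with 3-powers k
    ... | ._ , x∈ , (h , refl) , 1+2x≡3ᵏ⁺¹ with odd-representative (2 * (2 + 3 * h)) z<s (*-closed 2∈ (3k+2∈ {h} x∈))
    ...   | x′ , x′∈ , x′-odd , x′≡ = x′ , x′∈ , x′-odd , (begin
      (1 + 2 * x′) % n                    ≡⟨ +-cong-mod {a = 1} refl (*-cong-mod {a = 2} refl x′≡) ⟩
      (1 + 2 * (2 * (2 + 3 * h))) % n     ≡⟨ cong (_% n) (identity h) ⟩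
      (3 * (1 + 2 * (1 + 2 * h))) % n     ≡⟨ *-cong-mod {a = 3} refl 1+2x≡3ᵏ⁺¹ ⟩
      (3 * 3 ^ suc k) % n                 ∎)
      where
      identity : ∀ h → 1 + 2 * (2 * (2 + 3 * h)) ≡ 3 * (1 + 2 * (1 + 2 * h))
      identity = solve-∀

    ∈-if-≡2 : R n
    ∈-if-≡2 with ∃-order (prime∤⇒coprime prime[3] 3∤n)
    ... | m , 3ᵐ⁺¹≡1 with 3-powers m
    ...   | x , x∈ , (h , refl) , 1+2x≡3ᵐ⁺¹ = ∣-closed x∈ n∣x z<s
      where
      n∣2x : n ∣ 2 * x
      n∣2x = ≡-mod⇒∣∸ (trans (sym 3ᵐ⁺¹≡1) (sym 1+2x≡3ᵐ⁺¹))
      n∣x : n ∣ x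
      n∣x = coprime-divisor (prime∤⇒coprime prime[2] (odd⇒∤2 n-odd)) n∣2x

  -- With sᵐ⁺¹ ≡ 1 (mod n), t = j sᵐ is odd and t ≡ 2s sᵐ ≡ 2 (mod n).
  ∈-if-2s≡n+j : ∀ {n j s} .{{_ : NonZero n}} → Odd n → ¬ 3 ∣ n →
                R j → Odd j → Coprime n j → R s → Odd s → 2 * s ≡ n + j → R n
  ∈-if-2s≡n+j {n} {j} {s} n-odd 3∤n j∈ j-odd n⊥j s∈ s-odd 2s≡n+j
    with ∃-order (2s≡n+j⇒coprime {s = s} n⊥j 2s≡n+j)
  ... | m , sᵐ⁺¹≡1 = ∈-if-≡2 n-odd 3∤n (*-closed j∈ (^-closed s∈ m)) (odd-* j-odd (odd-^ s-odd m)) (begin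
    (j * s ^ m) % n      ≡⟨ *-cong-mod {c = s ^ m} j≡2s refl ⟩
    (2 * s * s ^ m) % n  ≡⟨ cong (_% n) (*-assoc 2 s (s ^ m)) ⟩
    (2 * s ^ suc m) % n  ≡⟨ *-cong-mod {a = 2} refl sᵐ⁺¹≡1 ⟩
    (2 * 1) % n          ∎)
    where
    j≡2s : j ≡ 2 * s mod n
    j≡2s = begin
      j % n        ≡⟨ [m+n]%n≡m%n j n ⟨
      (j + n) % n  ≡⟨ cong (_% n) (trans (+-comm j n) (sym 2s≡n+j)) ⟩
      (2 * s) % n  ∎

  -- 17 ≡ 2 (mod 5), 17² ≡ 2 (mod 7) and 5 · 7 ≡ 2 (mod 11).
  5∈ : R 5
  5∈ = ∈-if-≡2 (2 , refl) (from-no (3 ∣? 5)) 17∈ (8 , refl) refl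

  7∈ : R 7
  7∈ = ∈-if-≡2 (3 , refl) (from-no (3 ∣? 7)) (*-closed 17∈ 17∈) (144 , refl) refl

  11∈ : R 11
  11∈ = ∈-if-≡2 (5 , refl) (from-no (3 ∣? 11)) (*-closed 5∈ 7∈) (17 , refl) refl

  Below : ℕ → Set
  Below n = ∀ {m} → m < n → ¬ 3 ∣ m → R m

  Step : ℕ → Set
  Step n = Below n → ¬ 3 ∣ n → R n

  double : ∀ m → Step (2 * m)
  double zero    _  3∤0  = ⊥-elim (3∤0 (3 ∣0))
  double (suc m) IH 3∤2m = *-closed 2∈ (IH (m<m+n (suc m) z<s) (λ 3∣m → 3∤2m (∣n⇒∣m*n 2 3∣m)))

  even-residue : ∀ a q → Step (2 * a + q * 12)
  even-residue a q = subst Step (identity a q) (double (a + q * 6))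
    where
    identity : ∀ a q → 2 * (a + q * 6) ≡ 2 * a + q * 12
    identity = solve-∀

  3∣-residue : ∀ a q → Step (3 * a + q * 12)
  3∣-residue a q _ 3∤n = ⊥-elim (3∤n (divides (a + q * 4) (identity a q)))
    where
    identity : ∀ a q → 3 * a + q * 12 ≡ (a + q * 4) * 3
    identity = solve-∀

  -- For n = r + 12(q + 1) take j = r and s = r + 6(q + 1): both are smaller than n, odd and prime to 3.
  coprime-residue : ∀ r q → Odd r → ¬ 3 ∣ r → Coprime (r + suc q * 12) r → Step (r + suc q * 12)
  coprime-residue r@.(1 + 2 * h) q (h , refl) 3∤r n⊥r IH 3∤n =
    ∈-if-2s≡n+j n-odd 3∤n (IH r<n 3∤r) (h , refl) n⊥r (IH s<n 3∤s) s-odd (2s≡n+r h q)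
    where
    s = r + suc q * 6
    2s≡n+r : ∀ h q → 2 * ((1 + 2 * h) + suc q * 6) ≡ ((1 + 2 * h) + suc q * 12) + (1 + 2 * h)
    2s≡n+r = solve-∀
    n-odd : Odd (r + suc q * 12)
    n-odd = h + suc q * 6 , identity h q
      where
      identity : ∀ h q → (1 + 2 * h) + suc q * 12 ≡ 1 + 2 * (h + suc q * 6)
      identity = solve-∀
    s-odd : Odd s
    s-odd = h + suc q * 3 , identity h q
      where
      identity : ∀ h q → (1 + 2 * h) + suc q * 6 ≡ 1 + 2 * (h + suc q * 3)
      identity = solve-∀
    3∤s : ¬ 3 ∣ s
    3∤s 3∣s = 3∤r (∣m+n∣m⇒∣n (subst (3 ∣_) (+-comm r _) 3∣s) (∣n⇒∣m*n (suc q) (divides 2 refl)))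
    r<n : r < r + suc q * 12
    r<n = m<m+n r z<s
    s<n : s < r + suc q * 12
    s<n = +-monoʳ-< r (*-monoʳ-< (suc q) (from-yes (6 <? 12)))

  prime-residue : ∀ r q → Prime r → Odd r → ¬ 3 ∣ r → Step (r + suc q * 12)
  prime-residue r@.(1 + 2 * h) q r-prime (h , refl) 3∤r IH 3∤n with r ∣? r + suc q * 12
  ... | no r∤n = coprime-residue r q (h , refl) 3∤r (prime∤⇒coprime r-prime r∤n) IH 3∤n
  ... | yes (divides zero ())
  ... | yes (divides c@(suc _) n≡c*r) = subst R (sym n≡c*r) (*-closed (IH c<n 3∤c) (IH (m<m+n r z<s) 3∤r))
    where
    3∤c : ¬ 3 ∣ c
    3∤c 3∣c = 3∤n (subst (3 ∣_) (sym n≡c*r) (∣m⇒∣m*n r 3∣c))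
    c<n : c < r + suc q * 12
    c<n = subst (c <_) (sym n≡c*r) (m<m*n c r (nonTrivial⇒n>1 r {{prime⇒nonTrivial r-prime}}))

  by-residue : ∀ (r : Fin 12) q → Step (toℕ r + q * 12)
  by-residue 0F             q       = even-residue 0 q
  by-residue 1F             zero    = λ _ _ → 1∈
  by-residue 1F             (suc q) = coprime-residue 1 q (0 , refl) (from-no (3 ∣? 1)) (Coprime.sym (1-coprimeTo _))
  by-residue 2F             q       = even-residue 1 q
  by-residue 3F             q       = 3∣-residue 1 q
  by-residue 4F             q       = even-residue 2 q
  by-residue 5F             zero    = λ _ _ → 5∈
  by-residue 5F             (suc q) = prime-residue 5 q (from-yes (prime? 5)) (2 , refl) (from-no (3 ∣? 5))
  by-residue 6F             q       = even-residue 3 q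
  by-residue 7F             zero    = λ _ _ → 7∈
  by-residue 7F             (suc q) = prime-residue 7 q (from-yes (prime? 7)) (3 , refl) (from-no (3 ∣? 7))
  by-residue 8F             q       = even-residue 4 q
  by-residue 9F             q       = 3∣-residue 3 q
  by-residue (suc 9F)       q       = even-residue 5 q
  by-residue (suc (suc 9F)) zero    = λ _ _ → 11∈
  by-residue (suc (suc 9F)) (suc q) = prime-residue 11 q (from-yes (prime? 11)) (5 , refl) (from-no (3 ∣? 11))

  ∈-if-3∤ : ∀ n → ¬ 3 ∣ n → R n
  ∈-if-3∤ = <-rec _ step
    where
    step : ∀ n → Step n
    step n with n divMod 12
    ... | result q r refl = by-residue r q

[a/b]*[c/d]≡ac/bd : ∀ a b c d → (+ a ℚ./ suc b) ℚ.* (+ c ℚ./ suc d) ≡ + (a * c) ℚ./ (suc b * suc d)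
[a/b]*[c/d]≡ac/bd a b c d = ℚ.toℚᵘ-injective (begin
  ℚ.toℚᵘ (x ℚ.* y)                          ≈⟨ ℚ.toℚᵘ-homo-* x y ⟩
  ℚ.toℚᵘ x ℚᵘ.* ℚ.toℚᵘ y                    ≈⟨ ℚᵘ.*-cong (ℚ.toℚᵘ-fromℚᵘ (mkℚᵘ (+ a) b)) (ℚ.toℚᵘ-fromℚᵘ (mkℚᵘ (+ c) d)) ⟩
  mkℚᵘ (+ a ℤ.* + c) (pred (suc b * suc d))  ≡⟨ cong (λ i → mkℚᵘ i (pred (suc b * suc d))) (ℤ.pos-* a c) ⟨
  mkℚᵘ (+ (a * c)) (pred (suc b * suc d))    ≈⟨ ℚ.toℚᵘ-fromℚᵘ (mkℚᵘ (+ (a * c)) (pred (suc b * suc d))) ⟨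
  ℚ.toℚᵘ (+ (a * c) ℚ./ (suc b * suc d))    ∎)
  where
  open ℚᵘ.≃-Reasoning
  x = + a ℚ./ suc b
  y = + c ℚ./ suc d

*≡*⇒/≡/ : ∀ a b c d .{{_ : NonZero b}} .{{_ : NonZero d}} → a * d ≡ c * b → + a ℚ./ b ≡ + c ℚ./ d
*≡*⇒/≡/ a (suc b) c (suc d) ad≡cb = ℚ.fromℚᵘ-cong {mkℚᵘ (+ a) b} {mkℚᵘ (+ c) d}
  (ℚᵘ.*≡* (trans (sym (ℤ.pos-* a (suc d))) (trans (cong +_ ad≡cb) (ℤ.pos-* c (suc b)))))

[a/b]*[c/d]≡e/f : ∀ a b c d e f .{{_ : NonZero f}} →
                  a * c * f ≡ e * (suc b * suc d) → (+ a ℚ./ suc b) ℚ.* (+ c ℚ./ suc d) ≡ + e ℚ./ f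
[a/b]*[c/d]≡e/f a b c d e f acf≡ebd =
  trans ([a/b]*[c/d]≡ac/bd a b c d) (*≡*⇒/≡/ (a * c) (suc b * suc d) e f acf≡ebd)

q*r≡1⇒[p*q]*r≡p : ∀ p q r → q ℚ.* r ≡ 1ℚ → (p ℚ.* q) ℚ.* r ≡ p
q*r≡1⇒[p*q]*r≡p p q r qr≡1 = trans (ℚ.*-assoc p q r) (trans (cong (p ℚ.*_) qr≡1) (ℚ.*-identityʳ p))

∣↥[i/n]∣∣∣i∣ : ∀ i n .{{_ : NonZero n}} → ∣ ↥ (i ℚ./ n) ∣ ∣ ∣ i ∣
∣↥[i/n]∣∣∣i∣ i n = subst (∣ ↥ (i ℚ./ n) ∣ ∣_)
  (trans (sym (ℤ.abs-* (↥ (i ℚ./ n)) _)) (cong ∣_∣ (ℚ.↥-/ i n))) (m∣m*n _)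

∣↥[p*q]∣∣∣↥p∣*∣↥q∣ : ∀ p q → ∣ ↥ (p ℚ.* q) ∣ ∣ ∣ ↥ p ∣ * ∣ ↥ q ∣
∣↥[p*q]∣∣∣↥p∣*∣↥q∣ p q = subst (∣ ↥ (p ℚ.* q) ∣ ∣_)
  (trans (sym (ℤ.abs-* (↥ (p ℚ.* q)) _)) (trans (cong ∣_∣ (ℚ.↥-* p q)) (ℤ.abs-* (↥ p) (↥ q)))) (m∣m*n _)

↥⊥↧ : ∀ q → Coprime ∣ ↥ q ∣ (↧ₙ q)
↥⊥↧ (mkℚ _ _ coprime) = Coprime.recompute coprime

InW⇒positive : ∀ {q} → InW q → Positive q
InW⇒positive (W-gen n) =
  ℚ.normalize-pos (3 * n + 2) (suc (2 * n)) {{_}} {{≢-nonZero (m+1+n≢0 (3 * n))}}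
InW⇒positive W-half = _
InW⇒positive (W-mul {p} {q} p∈ q∈) = ℚ.pos*pos⇒pos p {{InW⇒positive p∈}} q {{InW⇒positive q∈}}

InW⇒3∤↥ : ∀ {q} → InW q → ¬ 3 ∣ ∣ ↥ q ∣
InW⇒3∤↥ (W-gen n) 3∣↥ =
  from-no (3 ∣? 2) (∣m+n∣m⇒∣n (∣-trans 3∣↥ (∣↥[i/n]∣∣∣i∣ (+ (3 * n + 2)) (suc (2 * n)))) (m∣m*n n))
InW⇒3∤↥ W-half = from-no (3 ∣? 1)
InW⇒3∤↥ (W-mul {p} {q} p∈ q∈) 3∣↥pq
  with euclidsLemma ∣ ↥ p ∣ ∣ ↥ q ∣ prime[3] (∣-trans 3∣↥pq (∣↥[p*q]∣∣∣↥p∣*∣↥q∣ p q))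
... | inj₁ 3∣↥p = InW⇒3∤↥ p∈ 3∣↥p
... | inj₂ 3∣↥q = InW⇒3∤↥ q∈ 3∣↥q

InW⇒coprime : ∀ {q} → InW q → 0ℚ ℚ.< q × Coprime ∣ ↥ q ∣ (3 * ↧ₙ q)
InW⇒coprime {q} q∈ =
  ℚ.positive⁻¹ q {{InW⇒positive q∈}} ,
  coprime-* (prime∤⇒coprime prime[3] (InW⇒3∤↥ q∈)) (↥⊥↧ q)

InWinv⇒∃inverse : ∀ {p} → InWinv p → ∃[ q ] InW q × p ℚ.* q ≡ 1ℚ
InWinv⇒∃inverse (Winv-gen n) = g n , W-gen n ,
  [a/b]*[c/d]≡e/f (2 * n + 1) (suc (3 * n)) (3 * n + 2) (2 * n) 1 1 (identity n)
  where
  identity : ∀ n → (2 * n + 1) * (3 * n + 2) * 1 ≡ 1 * (suc (suc (3 * n)) * suc (2 * n))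
  identity = solve-∀
InWinv⇒∃inverse Winv-two = ½ , W-half , refl
InWinv⇒∃inverse (Winv-mul {p} {q} p∈ q∈) with InWinv⇒∃inverse p∈ | InWinv⇒∃inverse q∈
... | p′ , p′∈ , pp′≡1 | q′ , q′∈ , qq′≡1 = p′ ℚ.* q′ , W-mul p′∈ q′∈ , (begin
  (p ℚ.* q) ℚ.* (p′ ℚ.* q′)  ≡⟨ cong ((p ℚ.* q) ℚ.*_) (ℚ.*-comm p′ q′) ⟩
  (p ℚ.* q) ℚ.* (q′ ℚ.* p′)  ≡⟨ ℚ.*-assoc (p ℚ.* q) q′ p′ ⟨
  ((p ℚ.* q) ℚ.* q′) ℚ.* p′  ≡⟨ cong (ℚ._* p′) (q*r≡1⇒[p*q]*r≡p p q q′ qq′≡1) ⟩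
  p ℚ.* p′                   ≡⟨ pp′≡1 ⟩
  1ℚ                         ∎)
  where open ≡-Reasoning

-- Found by computer search: g(449) g(237) ⋯ g(3) = 17 · 2⁹.
InW-17 : InW (+ 17 ℚ./ 1)
InW-17 = times-½ 9 (times-g (W-gen 449)
  (237 ∷ 9 ∷ 126 ∷ 36 ∷ 2165 ∷ 7787 ∷ 116 ∷ 77 ∷ 51 ∷ 68 ∷ 45 ∷ 957 ∷ 32 ∷ 416 ∷ 137 ∷ 3 ∷ 32 ∷ 21 ∷ 501 ∷ 192 ∷ 3 ∷ []))
  where
  times-g : ∀ {p} → InW p → (ns : List ℕ) → InW (foldl (λ q n → q ℚ.* g n) p ns)
  times-g p∈ []       = p∈
  times-g p∈ (n ∷ ns) = times-g (W-mul p∈ (W-gen n)) ns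
  times-½ : ∀ {p} k → InW p → InW (fold p (ℚ._* ½) k)
  times-½ zero    p∈ = p∈
  times-½ (suc k) p∈ = W-mul (times-½ k p∈) W-half

InWℕ : ℕ → Set
InWℕ n = InW (+ n ℚ./ 1)

module _ (weak : Weak3x+1) where

  InW-÷ : ∀ {p} d → InW (p ℚ.* (+ suc d ℚ./ 1)) → InW p
  InW-÷ {p} d p[1+d]∈ with InWinv⇒∃inverse (weak (suc d) (s≤s z≤n))
  ... | r , r∈ , [1+d]r≡1 = subst InW (q*r≡1⇒[p*q]*r≡p p _ r [1+d]r≡1) (W-mul p[1+d]∈ r∈)

  InWℕ-wildClosed : WildClosed InWℕ
  InWℕ-wildClosed = record
    { 2∈        = W-gen 0
    ; 17∈       = InW-17
    ; *-closed  = λ {a} {b} a∈ b∈ → subst InW ([a/b]*[c/d]≡e/f a 0 b 0 (a * b) 1 refl) (W-mul a∈ b∈)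
    ; *-cancelʳ = λ {a} {b} ab∈ → InW-÷ b (subst InW (sym ([a/b]*[c/d]≡e/f a 0 (suc b) 0 (a * suc b) 1 refl)) ab∈)
    ; 3k+2∈     = λ {k} 1+2k∈ → subst InW
                    ([a/b]*[c/d]≡e/f (3 * k + 2) (2 * k) (1 + 2 * k) 0 (2 + 3 * k) 1 (identity k))
                    (W-mul (W-gen k) 1+2k∈)
    }
    where
    identity : ∀ k → (3 * k + 2) * (1 + 2 * k) * 1 ≡ (2 + 3 * k) * (suc (2 * k) * 1)
    identity = solve-∀

  InWℕ⇒InW-/ : ∀ {a} d → InWℕ a → InW (+ a ℚ./ suc d)
  InWℕ⇒InW-/ {a} d a∈ =
    InW-÷ d (subst InW (sym ([a/b]*[c/d]≡e/f a d (suc d) 0 a 1 (*-assoc a (suc d) 1))) a∈)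

  coprime⇒InW : ∀ q → 0ℚ ℚ.< q → Coprime ∣ ↥ q ∣ (3 * ↧ₙ q) → InW q
  coprime⇒InW q@(mkℚ (+ a) d _) _ a⊥3[1+d] =
    subst InW (ℚ.↥p/↧p≡p q) (InWℕ⇒InW-/ {a} d (WildClosedProperties.∈-if-3∤ InWℕ-wildClosed a 3∤a))
    where
    3∤a : ¬ 3 ∣ a
    3∤a 3∣a with a⊥3[1+d] (3∣a , m∣m*n (suc d))
    ... | ()
  coprime⇒InW q@(mkℚ -[1+ _ ] _ _) 0<q _ with ℚ.positive {q} 0<q
  ... | ()

theorem3p5 : Weak3x+1 → ∀ (q : ℚ) → InW q ⇔ (0ℚ ℚ.< q × Coprime ∣ ↥ q ∣ (3 * ↧ₙ q))
theorem3p5 weak q = mk⇔ InW⇒coprime (λ (0<q , q⊥3↧q) → coprime⇒InW weak q 0<q q⊥3↧q)
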